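{- Let $M$ be a monoid. Then $\mathbb{X}(M)$ is a strong $M$-partial order.
   Context: For a monoid $M$, an $M$-partial order is a set $X$ with an action of $M$ (the identity of $M$ acting as the identity) and a partial order $\leq_X$ such that $x\leq_X y$ implies $ax\leq_X ay$ for all $x,y\in X$, $a\in M$. An $M$-partial order $X$ is strong if for all $y\in X$ and $a\in M$, $\{ax : x\in X,\ x\leq_X y\} = \{x\in X : x\leq_X ay\}$. $\mathbb{X}(M)=\{aM : a\in M\}$ is the set of principal right ideals of $M$, ordered by inclusion, with $M$ acting by left multiplication: $b\cdot(aM)=baM$. -}

module Defs where

open import Level using (Level; _⊔_; suc)
open import Algebra.Bundles using (Monoid)
open import Data.Product using (Σ; ∃; _×_; _,_)
open import Function.Bundles using (_⇔_)
open import Relation.Binary.Core using (Rel)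
open import Relation.Binary.Structures using (IsPartialOrder)

-- Raw data of a set with a left action of a monoid, an equality (setoid
-- equality, since Agda has no quotients) and an order.
record RawMPoset {c ℓ : Level} (M : Monoid c ℓ) (x e o : Level)
         : Set (c ⊔ ℓ ⊔ suc (x ⊔ e ⊔ o)) where
  open Monoid M renaming (Carrier to A; _≈_ to _≈M_)
  field
    X    : Set x
    _≈X_ : Rel X e
    _≤X_ : Rel X o
    act  : A → X → X

record IsMPartialOrder {c ℓ x e o : Level} {M : Monoid c ℓ}
         (P : RawMPoset M x e o) : Set (c ⊔ ℓ ⊔ x ⊔ e ⊔ o) where
  open Monoid M renaming (Carrier to A; _≈_ to _≈M_)
  open RawMPoset P
  field
    isPartialOrder : IsPartialOrder _≈X_ _≤X_
    act-cong       : ∀ {a b : A} {y z : X} → a ≈M b → y ≈X z → act a y ≈X act b z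
    act-identity   : ∀ (y : X) → act ε y ≈X y
    act-assoc      : ∀ (a b : A) (y : X) → act (a ∙ b) y ≈X act a (act b y)
    act-mono       : ∀ {y z : X} (a : A) → y ≤X z → act a y ≤X act a z

-- Strong: for all y, a:  { a x : x ≤ y } = { x : x ≤ a y }  (as subsets of X,
-- membership taken up to the equality of X).
IsStrong : {c ℓ x e o : Level} {M : Monoid c ℓ} → RawMPoset M x e o → Set (c ⊔ x ⊔ e ⊔ o)
IsStrong {M = M} P =
  ∀ (y : X) (a : Monoid.Carrier M) (z : X) →
    (∃ λ (w : X) → (w ≤X y) × (z ≈X act a w)) ⇔ (z ≤X act a y)
  where open RawMPoset P

principalRightIdeal : {c ℓ : Level} (M : Monoid c ℓ) → Monoid.Carrier M → Monoid.Carrier M → Set (c ⊔ ℓ)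
principalRightIdeal M a z = ∃ λ m → z ≈ a ∙ m
  where open Monoid M

Included : {c ℓ : Level} (M : Monoid c ℓ) → (Monoid.Carrier M → Set (c ⊔ ℓ)) → (Monoid.Carrier M → Set (c ⊔ ℓ)) → Set (c ⊔ ℓ)
Included M I J = ∀ (z : Monoid.Carrier M) → I z → J z

-- 𝕏(M): the principal right ideals aM (represented by a generator a), two
-- representatives being equal iff the ideals are equal as sets; order =
-- inclusion of ideals; action b·(aM) = (ba)M.
𝕏 : {c ℓ : Level} (M : Monoid c ℓ) → RawMPoset M c (c ⊔ ℓ) (c ⊔ ℓ)
𝕏 M = record
  { X    = Carrier
  ; _≈X_ = λ a b → Included M (principalRightIdeal M a) (principalRightIdeal M b)
                 × Included M (principalRightIdeal M b) (principalRightIdeal M a)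
  ; _≤X_ = λ a b → Included M (principalRightIdeal M a) (principalRightIdeal M b)
  ; act  = λ b a → b ∙ a
  }
  where open Monoid M

-- In 𝕏(M) the order aM ⊆ bM is just the membership a ∈ bM, and membership
-- is preserved by left multiplication.  For strongness, z ∈ (ay)M means
-- z ≈ a(yn) for some n, and w := yn is the required element below y.
module Submission where

open import Defs
open import Level using (Level; _⊔_)
open import Algebra.Bundles using (Monoid)
open import Data.Product using (_×_; _,_; proj₁; ∃)
open import Function.Bundles using (mk⇔)
open import Relation.Binary.Structures using (IsPartialOrder)
import Relation.Binary.Reasoning.Setoid as SetoidReasoning

module PrincipalRightIdeals {c ℓ : Level} (M : Monoid c ℓ) where
  open Monoid M
  open SetoidReasoning setoid
  open RawMPoset (𝕏 M) using (_≈X_; _≤X_)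

  _∈_M : Carrier → Carrier → Set (c ⊔ ℓ)
  z ∈ a M = principalRightIdeal M a z

  ∈-refl : ∀ a → a ∈ a M
  ∈-refl a = ε , sym (identityʳ a)

  ≈⇒∈ : ∀ {u v} → u ≈ v → u ∈ v M
  ≈⇒∈ {u} {v} u≈v = ε , trans u≈v (sym (identityʳ v))

  ∈⇒⊆ : ∀ {u v} → u ∈ v M → u ≤X v
  ∈⇒⊆ {u} {v} (k , u≈vk) t (m , t≈um) = k ∙ m , (begin
    t           ≈⟨ t≈um ⟩
    u ∙ m       ≈⟨ ∙-congʳ u≈vk ⟩
    (v ∙ k) ∙ m ≈⟨ assoc v k m ⟩
    v ∙ (k ∙ m) ∎)

  ⊆⇒∈ : ∀ {u v} → u ≤X v → u ∈ v M
  ⊆⇒∈ {u} u⊆v = u⊆v u (∈-refl u)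

  ≈⇒≈X : ∀ {u v} → u ≈ v → u ≈X v
  ≈⇒≈X u≈v = ∈⇒⊆ (≈⇒∈ u≈v) , ∈⇒⊆ (≈⇒∈ (sym u≈v))

  ∈-∙-cong : ∀ {a b u v} → a ≈ b → u ∈ v M → (a ∙ u) ∈ (b ∙ v) M
  ∈-∙-cong {a} {b} {u} {v} a≈b (k , u≈vk) = k , (begin
    a ∙ u       ≈⟨ ∙-cong a≈b u≈vk ⟩
    b ∙ (v ∙ k) ≈⟨ sym (assoc b v k) ⟩
    (b ∙ v) ∙ k ∎)

  ≤X-∙-cong : ∀ {a b u v} → a ≈ b → u ≤X v → (a ∙ u) ≤X (b ∙ v)
  ≤X-∙-cong a≈b u≤v = ∈⇒⊆ (∈-∙-cong a≈b (⊆⇒∈ u≤v))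

  ⊆-trans : ∀ {u v w} → u ≤X v → v ≤X w → u ≤X w
  ⊆-trans u≤v v≤w z z∈uM = v≤w z (u≤v z z∈uM)

  isPartialOrder : IsPartialOrder _≈X_ _≤X_
  isPartialOrder = record
    { isPreorder = record
      { isEquivalence = record
        { refl  = (λ _ z∈ → z∈) , (λ _ z∈ → z∈)
        ; sym   = λ (u≤v , v≤u) → v≤u , u≤v
        ; trans = λ (u≤v , v≤u) (v≤w , w≤v) → ⊆-trans u≤v v≤w , ⊆-trans w≤v v≤u
        }
      ; reflexive = proj₁
      ; trans     = ⊆-trans
      }
    ; antisym = _,_
    }

  isMPartialOrder : IsMPartialOrder (𝕏 M)
  isMPartialOrder = record
    { isPartialOrder = isPartialOrder
    ; act-cong       = λ a≈b (u≤v , v≤u) → ≤X-∙-cong a≈b u≤v , ≤X-∙-cong (sym a≈b) v≤u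
    ; act-identity   = λ y → ≈⇒≈X (identityˡ y)
    ; act-assoc      = λ a b y → ≈⇒≈X (assoc a b y)
    ; act-mono       = λ a → ≤X-∙-cong refl
    }

  isStrong : IsStrong (𝕏 M)
  isStrong y a z = mk⇔ below⇒ ⇒below
    where
    below⇒ : ∃ (λ w → w ≤X y × z ≈X (a ∙ w)) → z ≤X (a ∙ y)
    below⇒ (w , w≤y , z≤aw , _) = ⊆-trans z≤aw (≤X-∙-cong refl w≤y)

    ⇒below : z ≤X (a ∙ y) → ∃ (λ w → w ≤X y × z ≈X (a ∙ w))
    ⇒below z≤ay with ⊆⇒∈ z≤ay
    ... | n , z≈[ay]n = y ∙ n , ∈⇒⊆ (n , refl) , ≈⇒≈X (trans z≈[ay]n (assoc a y n))

lemma2p1 : {c ℓ : Level} (M : Monoid c ℓ) → IsMPartialOrder (𝕏 M) × IsStrong (𝕏 M)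
lemma2p1 M = isMPartialOrder , isStrong
  where open PrincipalRightIdeals M
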